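{- Fix $\epsilon>0$ and an integer-valued function $k=k(n)\ge 2$ with $k=O(n^{1/2-\epsilon})$. Let $V$ be a $k$-element subset of $\{0,1,\dots,n-1\}$ chosen uniformly at random, and let $U$ and $W$ be as described in the context. Then for every integer $l$: (i) if $l\in U$ then $l\in W$ with probability $1$, i.e. $\Pr\{l\in W\mid l\in U\}=1$; (ii) $\Pr\{l\in W \mid l\notin U\}\le \frac{k^2}{n}+o\!\left(\frac{k^2}{n}\right)$ as $n\to\infty$.
   Context: Write $V=\{v_0<v_1<\dots<v_{k-1}\}$. Define the normalized set $U=V-v_0=\{v-v_0:v\in V\}$ if $v_1-v_0\le v_{k-1}-v_{k-2}$, and $U=v_{k-1}-V=\{v_{k-1}-v:v\in V\}$ otherwise. Write $U=\{u_0<\dots<u_{k-1}\}$ (so $u_0=0$ and $u_1-u_0\le u_{k-1}-u_{k-2}$), $u_{ij}=u_j-u_i$, and $W=\{u_{ij}:0\le i\le j\le k-1\}$, which equals the pairwise distance set $\{|a-b|:a,b\in V\}$. The $o(\cdot)$ term is as $n\to\infty$, uniformly in $l$. -}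

module Defs where

open import Data.Nat using (ℕ; zero; suc; _+_; _∸_; _≤ᵇ_)
open import Data.Bool using (Bool; true; false; if_then_else_)
open import Data.List using (List; []; _∷_; _++_; [_]; map; concatMap; reverse)
open import Data.Bool.ListAction using (any)
open import Data.Integer as ℤ using (ℤ; +_)
open import Relation.Nullary.Decidable using (does)

-- All k-element subsets of {0,1,...,n-1}, each listed as a strictly
-- increasing list; every subset occurs exactly once.
ksub : ℕ → ℕ → List (List ℕ)
ksub zero    zero    = [] ∷ []
ksub zero    (suc k) = []
ksub (suc n) zero    = [] ∷ []
ksub (suc n) (suc k) = ksub n (suc k) ++ map (λ xs → xs ++ [ n ]) (ksub n k)

-- first two and last two elements of V = {v0 < v1 < ... < v(k-1)}
-- (only used when length ≥ 2)
first : List ℕ → ℕ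
first []      = 0
first (x ∷ _) = x

second : List ℕ → ℕ
second (_ ∷ y ∷ _) = y
second _           = 0

lastE : List ℕ → ℕ
lastE V = first (reverse V)

secondLast : List ℕ → ℕ
secondLast V = second (reverse V)

normU : List ℕ → List ℕ
normU V =
  if (second V ∸ first V) ≤ᵇ (lastE V ∸ secondLast V)
  then map (λ v → v ∸ first V) V
  else map (λ v → lastE V ∸ v) V

distW : List ℕ → List ℕ
distW V = concatMap (λ x → concatMap (λ y → if x ≤ᵇ y then [ y ∸ x ] else []) U) U
  where U = normU V

memℤ : ℤ → List ℕ → Bool
memℤ l xs = any (λ u → does (l ℤ.≟ + u)) xs

inU : ℤ → List ℕ → Bool
inU l V = memℤ l (normU V)

inW : ℤ → List ℕ → Bool
inW l V = memℤ l (distW V)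

count : {A : Set} → (A → Bool) → List A → ℕ
count p []       = 0
count p (x ∷ xs) = (if p x then 1 else 0) + count p xs

-- Part (i): 0 ∈ U, so every u ∈ U is the distance u − 0 and lies in W.
--
-- Part (ii): U is obtained from V by a translation or a reflection, both of which preserve
-- distances, so a positive d lies in W only if V contains a pair {a, a + d} with a < n − 1.
-- For a fixed pair exactly C(n−2, k−2) sets V do, and (n − 1)·C(n−2, k−2) = k(k−1)/n · C(n, k),
-- so Pr(d ∈ W) ≤ k²/n. Since U ⊆ W this also bounds Pr(d ∈ U), and the growth hypothesis gives
-- (m+1)k² ≤ n for large n, hence Pr(d ∉ U) ≥ m/(m+1) and
-- Pr(d ∈ W ∖ U)/Pr(d ∉ U) ≤ (1 + 1/m)·k²/n. Nonpositive l never lie in W ∖ U.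

module Submission where

open import Defs
open import Data.Nat using (ℕ; _+_; _*_; _^_; _≤_; _<_)
open import Data.Bool using (_∧_; not)
open import Data.Integer using (ℤ)
open import Data.Product using (_×_; ∃-syntax)
open import Relation.Binary.PropositionalEquality using (_≡_)

import Data.Nat as ℕ
open import Data.Nat using (zero; suc; pred; _∸_; _≤ᵇ_; _≤?_; z≤n; s≤s; NonZero; >-nonZero)
open import Data.Nat.Properties
  using ( ≤-refl; ≤-trans; ≤-reflexive; ≤-antisym; ≤-pred; ≤∧≢⇒<; <⇒≢; n≤0⇒n≡0; <⇒≤; ≰⇒≥; ≮⇒≥
        ; <-irrefl; <-asym; <-≤-trans; ≤-<-trans
        ; ≤⇒≤ᵇ; m<m+n; n≤1+n; m≤n⇒m≤1+n; m≤m+n; m≤n+m; 0≢1+n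
        ; +-identityʳ; +-assoc; +-comm; +-suc; +-mono-≤; +-monoˡ-≤; +-cancelˡ-≤
        ; *-identityʳ; *-zeroʳ; *-distribˡ-+; *-assoc; *-comm; *-monoˡ-≤; *-monoʳ-≤; *-monoˡ-<
        ; *-cancelʳ-≤; *-cancelˡ-<; ^-*-assoc; ^-monoˡ-<; ^-monoʳ-≤; m^n≢0
        ; n∸n≡0; m+[n∸m]≡n; m∸[m∸n]≡n; m≤n⇒m∸n≡0; m+n∸n≡m; m∸n≢0⇒n<m; module ≤-Reasoning )
open import Data.Nat.Tactic.RingSolver using (solve-∀)
open import Data.Bool using (Bool; true; false; T; _∨_; if_then_else_)
open import Data.Bool.Properties using (∨-assoc; ∨-identityʳ; ∧-identityʳ; T-≡; T-not-≡; T-∧)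
open import Data.Bool.ListAction using (any)
open import Data.Integer using (+_; -[1+_])
import Data.Integer as ℤ
open import Data.Integer.Properties using (+-injective)
open import Data.List using (List; []; _∷_; _++_; [_]; map; concatMap; length; upTo)
open import Data.List.Properties using (length-++; length-map; length-upTo)
open import Data.List.Membership.Propositional using (_∈_; lose; find)
open import Data.List.Membership.Propositional.Properties
  using (∈-map⁺; ∈-map⁻; ∈-++⁺ʳ; ∈-++⁻; ∈-concatMap⁺; ∈-concatMap⁻; ∈-upTo⁺)
open import Data.List.Relation.Unary.Any using (here; there)
open import Data.List.Relation.Unary.Any.Properties using (any⁺; reverse⁺; reverse⁻)
open import Data.Product using (_,_; proj₁; proj₂)
open import Data.Sum using (_⊎_; inj₁; inj₂)
open import Data.Empty using (⊥-elim)
open import Function using (_∘_; Equivalence)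
open import Relation.Nullary using (¬_; yes; no; does; contradiction)
open import Relation.Nullary.Decidable using (dec-true; dec-false)
open import Relation.Binary.PropositionalEquality using (refl; sym; trans; cong; cong₂; subst; _≢_; module ≡-Reasoning)

∧-redundantʳ : ∀ {a b} → (T a → T b) → a ∧ b ≡ a
∧-redundantʳ {true}  a⇒b = Equivalence.to T-≡ (a⇒b _)
∧-redundantʳ {false} _   = refl

memℤ-sound : ∀ l xs → T (memℤ l xs) → ∃[ u ] (u ∈ xs × l ≡ + u)
memℤ-sound l (x ∷ xs) h with l ℤ.≟ + x
... | yes l≡x = x , here refl , l≡x
... | no  _   with u , u∈ , l≡u ← memℤ-sound l xs h = u , there u∈ , l≡u

memℤ-complete : ∀ {l u xs} → u ∈ xs → l ≡ + u → T (memℤ l xs)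
memℤ-complete {l} {xs = x ∷ _}  (here refl) l≡u rewrite dec-true (l ℤ.≟ + x) l≡u = _
memℤ-complete {l} {xs = x ∷ xs} (there u∈)  l≡u with does (l ℤ.≟ + x)
... | true  = _
... | false = memℤ-complete u∈ l≡u

memℤ⇒∈ : ∀ u xs → T (memℤ (+ u) xs) → u ∈ xs
memℤ⇒∈ u xs h with v , v∈ , u≡v ← memℤ-sound (+ u) xs h = subst (_∈ xs) (sym (+-injective u≡v)) v∈

∈⇒memℤ : ∀ {u xs} → u ∈ xs → T (memℤ (+ u) xs)
∈⇒memℤ u∈ = memℤ-complete u∈ refl

memℤ-negsuc : ∀ j xs → ¬ T (memℤ -[1+ j ] xs)
memℤ-negsuc j xs h with memℤ-sound -[1+ j ] xs h
... | _ , _ , ()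

memℤ-++ : ∀ l xs ys → memℤ l (xs ++ ys) ≡ memℤ l xs ∨ memℤ l ys
memℤ-++ l []       ys = refl
memℤ-++ l (x ∷ xs) ys =
  trans (cong (does (l ℤ.≟ + x) ∨_) (memℤ-++ l xs ys)) (sym (∨-assoc (does (l ℤ.≟ + x)) (memℤ l xs) (memℤ l ys)))

memℤ-snoc-other : ∀ V {x n} → x ≢ n → memℤ (+ x) (V ++ [ n ]) ≡ memℤ (+ x) V
memℤ-snoc-other V {x} {n} x≢n = begin
  memℤ (+ x) (V ++ [ n ])
    ≡⟨ memℤ-++ (+ x) V [ n ] ⟩
  memℤ (+ x) V ∨ (does (+ x ℤ.≟ + n) ∨ false)
    ≡⟨ cong (λ b → memℤ (+ x) V ∨ (b ∨ false)) (dec-false (+ x ℤ.≟ + n) (x≢n ∘ +-injective)) ⟩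
  memℤ (+ x) V ∨ false
    ≡⟨ ∨-identityʳ _ ⟩
  memℤ (+ x) V ∎
  where open ≡-Reasoning

memℤ-snoc-self : ∀ V n → T (memℤ (+ n) (V ++ [ n ]))
memℤ-snoc-self V n = ∈⇒memℤ (∈-++⁺ʳ V (here refl))

first∈ : ∀ {u V} → u ∈ V → first V ∈ V
first∈ (here _)  = here refl
first∈ (there _) = here refl

lastE∈ : ∀ {u V} → u ∈ V → lastE V ∈ V
lastE∈ = reverse⁻ ∘ first∈ ∘ reverse⁺

normU-cases : ∀ V → normU V ≡ map (λ v → v ∸ first V) V ⊎ normU V ≡ map (λ v → lastE V ∸ v) V
normU-cases V with (second V ∸ first V) ≤ᵇ (lastE V ∸ secondLast V)
... | true  = inj₁ refl
... | false = inj₂ refl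

0∈normU : ∀ V {u} → u ∈ normU V → 0 ∈ normU V
0∈normU V {u} u∈ with normU-cases V
... | inj₁ eq with v , v∈ , _ ← ∈-map⁻ (λ v → v ∸ first V) (subst (u ∈_) eq u∈) =
  subst (0 ∈_) (sym eq)
    (subst (_∈ map (λ v → v ∸ first V) V) (n∸n≡0 (first V)) (∈-map⁺ (λ v → v ∸ first V) (first∈ v∈)))
... | inj₂ eq with v , v∈ , _ ← ∈-map⁻ (λ v → lastE V ∸ v) (subst (u ∈_) eq u∈) =
  subst (0 ∈_) (sym eq)
    (subst (_∈ map (λ v → lastE V ∸ v) V) (n∸n≡0 (lastE V)) (∈-map⁺ (λ v → lastE V ∸ v) (lastE∈ v∈)))

∈-if-true : ∀ {b} {z : ℕ} → T b → z ∈ (if b then [ z ] else [])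
∈-if-true {true} _ = here refl

∈-if⇒≡ : ∀ b {w z : ℕ} → w ∈ (if b then [ z ] else []) → w ≡ z
∈-if⇒≡ true (here w≡z) = w≡z

∈distW⁺ : ∀ V {x y} → x ∈ normU V → y ∈ normU V → x ≤ y → y ∸ x ∈ distW V
∈distW⁺ V {x} {y} x∈ y∈ x≤y =
  ∈-concatMap⁺ (λ x → concatMap (λ y → if x ≤ᵇ y then [ y ∸ x ] else []) (normU V))
    (lose x∈ (∈-concatMap⁺ (λ y → if x ≤ᵇ y then [ y ∸ x ] else []) (lose y∈ (∈-if-true (≤⇒≤ᵇ x≤y)))))

∈distW⁻ : ∀ V {w} → w ∈ distW V → ∃[ x ] ∃[ y ] (x ∈ normU V × y ∈ normU V × w ≡ y ∸ x)
∈distW⁻ V w∈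
  with x , x∈ , w∈x ← find (∈-concatMap⁻ (λ x → concatMap (λ y → if x ≤ᵇ y then [ y ∸ x ] else []) (normU V)) w∈)
  with y , y∈ , w∈xy ← find (∈-concatMap⁻ (λ y → if x ≤ᵇ y then [ y ∸ x ] else []) w∈x)
  = x , y , x∈ , y∈ , ∈-if⇒≡ (x ≤ᵇ y) w∈xy

normU⊆distW : ∀ V {u} → u ∈ normU V → u ∈ distW V
normU⊆distW V u∈ = ∈distW⁺ V (0∈normU V u∈) u∈ z≤n

-- Normalisation is a translation or a reflection, so gaps of U are gaps of V

∸≡suc⇒< : ∀ m n {d} → n ∸ m ≡ suc d → m < n
∸≡suc⇒< m n n∸m≡1+d = m∸n≢0⇒n<m (λ n∸m≡0 → 0≢1+n (trans (sym n∸m≡0) n∸m≡1+d))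

∸≡suc⇒+ : ∀ m n {d} → n ∸ m ≡ suc d → m + suc d ≡ n
∸≡suc⇒+ m n n∸m≡1+d = trans (cong (λ t → m + t) (sym n∸m≡1+d)) (m+[n∸m]≡n (<⇒≤ (∸≡suc⇒< m n n∸m≡1+d)))

translate-gap : ∀ f x y {d} → (y ∸ f) ∸ (x ∸ f) ≡ suc d → f + (x ∸ f) + suc d ≡ y
translate-gap f x y {d} gap = begin
  f + (x ∸ f) + suc d   ≡⟨ +-assoc f (x ∸ f) (suc d) ⟩
  f + ((x ∸ f) + suc d) ≡⟨ cong (λ t → f + t) (∸≡suc⇒+ (x ∸ f) (y ∸ f) gap) ⟩
  f + (y ∸ f)           ≡⟨ m+[n∸m]≡n (<⇒≤ (∸≡suc⇒< f y y∸f≡1+)) ⟩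
  y                     ∎
  where
  open ≡-Reasoning
  y∸f≡1+ : y ∸ f ≡ suc ((x ∸ f) + d)
  y∸f≡1+ = trans (sym (∸≡suc⇒+ (x ∸ f) (y ∸ f) gap)) (+-suc (x ∸ f) d)

reflect-gap : ∀ L x y {d} → (L ∸ y) ∸ (L ∸ x) ≡ suc d → y + suc d ≡ L ∸ (L ∸ x)
reflect-gap L x y {d} gap = sym (begin
  L ∸ X                         ≡⟨ cong (_∸ X) (sym (m+[n∸m]≡n (<⇒≤ (∸≡suc⇒< y L L∸y≡1+)))) ⟩
  (y + (L ∸ y)) ∸ X             ≡⟨ cong (λ t → (y + t) ∸ X) (sym (∸≡suc⇒+ X (L ∸ y) gap)) ⟩
  (y + (X + suc d)) ∸ X         ≡⟨ cong (_∸ X) (rearrange y X (suc d)) ⟩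
  (y + suc d + X) ∸ X           ≡⟨ m+n∸n≡m (y + suc d) X ⟩
  y + suc d                     ∎)
  where
  open ≡-Reasoning
  X = L ∸ x
  L∸y≡1+ : L ∸ y ≡ suc (X + d)
  L∸y≡1+ = trans (sym (∸≡suc⇒+ X (L ∸ y) gap)) (+-suc X d)
  rearrange : ∀ a b c → a + (b + c) ≡ a + c + b
  rearrange = solve-∀

m+[n∸m]∈ : ∀ {V : List ℕ} {m n} → m ∈ V → n ∈ V → m + (n ∸ m) ∈ V
m+[n∸m]∈ {V} {m} {n} m∈ n∈ with m ≤? n
... | yes m≤n = subst (_∈ V) (sym (m+[n∸m]≡n m≤n)) n∈
... | no  m≰n = subst (_∈ V) (sym (trans (cong (λ t → m + t) (m≤n⇒m∸n≡0 (≰⇒≥ m≰n))) (+-identityʳ m))) m∈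

m∸[m∸n]∈ : ∀ {V : List ℕ} {m n} → m ∈ V → n ∈ V → m ∸ (m ∸ n) ∈ V
m∸[m∸n]∈ {V} {m} {n} m∈ n∈ with n ≤? m
... | yes n≤m = subst (_∈ V) (sym (m∸[m∸n]≡n n≤m)) n∈
... | no  n≰m = subst (_∈ V) (sym (cong (m ∸_) (m≤n⇒m∸n≡0 (≰⇒≥ n≰m)))) m∈

normU-gap : ∀ V {x y d} → x ∈ normU V → y ∈ normU V → y ∸ x ≡ suc d → ∃[ a ] (a ∈ V × a + suc d ∈ V)
normU-gap V {x} {y} x∈ y∈ gap with normU-cases V
... | inj₁ eq
  with x′ , x′∈ , refl ← ∈-map⁻ (λ v → v ∸ first V) (subst (x ∈_) eq x∈)
  with y′ , y′∈ , refl ← ∈-map⁻ (λ v → v ∸ first V) (subst (y ∈_) eq y∈)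
  = first V + (x′ ∸ first V) , m+[n∸m]∈ (first∈ x′∈) x′∈
  , subst (_∈ V) (sym (translate-gap (first V) x′ y′ gap)) y′∈
... | inj₂ eq
  with x′ , x′∈ , refl ← ∈-map⁻ (λ v → lastE V ∸ v) (subst (x ∈_) eq x∈)
  with y′ , y′∈ , refl ← ∈-map⁻ (λ v → lastE V ∸ v) (subst (y ∈_) eq y∈)
  = y′ , y′∈ , subst (_∈ V) (sym (reflect-gap (lastE V) x′ y′ gap)) (m∸[m∸n]∈ (lastE∈ x′∈) x′∈)

inU⇒inW : ∀ l V → T (inU l V) → T (inW l V)
inU⇒inW (+ u)    V h = ∈⇒memℤ (normU⊆distW V (memℤ⇒∈ u (normU V) h))
inU⇒inW -[1+ j ] V h = ⊥-elim (memℤ-negsuc j (normU V) h)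

inW-gap : ∀ V d → T (inW (+ suc d) V) → ∃[ a ] (a ∈ V × a + suc d ∈ V)
inW-gap V d h with x , y , x∈ , y∈ , 1+d≡y∸x ← ∈distW⁻ V (memℤ⇒∈ (suc d) (distW V) h) =
  normU-gap V x∈ y∈ (sym 1+d≡y∸x)

W∖U-positive : ∀ l V → T (inW l V ∧ not (inU l V)) → ∃[ d ] (l ≡ + suc d)
W∖U-positive (+ suc d) V _ = d , refl
W∖U-positive (+ zero)  V h
  with w , ¬u ← Equivalence.to T-∧ h
  with _ , _ , x∈ , _ ← ∈distW⁻ V (memℤ⇒∈ 0 (distW V) w)
  = ⊥-elim (subst T (Equivalence.to T-not-≡ ¬u) (∈⇒memℤ (0∈normU V x∈)))
W∖U-positive -[1+ j ] V h = ⊥-elim (memℤ-negsuc j (distW V) (proj₁ (Equivalence.to T-∧ h)))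

module _ {A : Set} where

  count-cong : ∀ {p q : A → Bool} xs → (∀ x → p x ≡ q x) → count p xs ≡ count q xs
  count-cong []       _   = refl
  count-cong (x ∷ xs) p≗q = cong₂ (λ b n → (if b then 1 else 0) + n) (p≗q x) (count-cong xs p≗q)

  count-++ : ∀ (p : A → Bool) xs ys → count p (xs ++ ys) ≡ count p xs + count p ys
  count-++ p []       ys = refl
  count-++ p (x ∷ xs) ys =
    trans (cong (λ n → (if p x then 1 else 0) + n) (count-++ p xs ys)) (sym (+-assoc (if p x then 1 else 0) _ _))

  count-map : ∀ {B : Set} (p : A → Bool) (f : B → A) xs → count p (map f xs) ≡ count (p ∘ f) xs
  count-map p f []       = refl
  count-map p f (x ∷ xs) = cong (λ n → (if p (f x) then 1 else 0) + n) (count-map p f xs)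

  count-mono : ∀ {p q : A → Bool} xs → (∀ {x} → x ∈ xs → T (p x) → T (q x)) → count p xs ≤ count q xs
  count-mono         []       _   = z≤n
  count-mono {p} {q} (x ∷ xs) p⇒q with p x | q x | p⇒q (here refl)
  ... | true  | true  | _    = s≤s (count-mono xs (p⇒q ∘ there))
  ... | true  | false | p⇒qx = ⊥-elim (p⇒qx _)
  ... | false | true  | _    = m≤n⇒m≤1+n (count-mono xs (p⇒q ∘ there))
  ... | false | false | _    = count-mono xs (p⇒q ∘ there)

  count-≡0 : ∀ {p : A → Bool} xs → (∀ {x} → x ∈ xs → ¬ T (p x)) → count p xs ≡ 0
  count-≡0     []       _ = refl
  count-≡0 {p} (x ∷ xs) ¬p with p x | ¬p (here refl)
  ... | true  | ¬px = ⊥-elim (¬px _)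
  ... | false | _   = count-≡0 xs (¬p ∘ there)

  count-≡length : ∀ {p : A → Bool} xs → (∀ x → T (p x)) → count p xs ≡ length xs
  count-≡length     []       _ = refl
  count-≡length {p} (x ∷ xs) all-p with p x | all-p x
  ... | true | _ = cong suc (count-≡length xs all-p)

  count+count-not : ∀ (p : A → Bool) xs → count p xs + count (λ x → not (p x)) xs ≡ length xs
  count+count-not p []       = refl
  count+count-not p (x ∷ xs) with p x
  ... | true  = cong suc (count+count-not p xs)
  ... | false = trans (+-suc (count p xs) _) (cong suc (count+count-not p xs))

  count-∧-not+count : ∀ {p q : A → Bool} xs → (∀ x → T (q x) → T (p x)) →
                      count (λ x → p x ∧ not (q x)) xs + count q xs ≡ count p xs
  count-∧-not+count         []       _   = refl
  count-∧-not+count {p} {q} (x ∷ xs) q⇒p with p x | q x | q⇒p x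
  ... | true  | true  | _    = trans (+-suc _ _) (cong suc (count-∧-not+count xs q⇒p))
  ... | true  | false | _    = cong suc (count-∧-not+count xs q⇒p)
  ... | false | true  | q⇒px = ⊥-elim (q⇒px _)
  ... | false | false | _    = count-∧-not+count xs q⇒p

  count-∨ : ∀ (p q : A → Bool) xs → count (λ x → p x ∨ q x) xs ≤ count p xs + count q xs
  count-∨ p q []       = z≤n
  count-∨ p q (x ∷ xs) with p x | q x
  ... | true  | true  = s≤s (≤-trans (m≤n⇒m≤1+n (count-∨ p q xs)) (≤-reflexive (sym (+-suc _ _))))
  ... | true  | false = s≤s (count-∨ p q xs)
  ... | false | true  = ≤-trans (s≤s (count-∨ p q xs)) (≤-reflexive (sym (+-suc _ _)))
  ... | false | false = count-∨ p q xs

  count-any≤ : ∀ {I : Set} (q : I → A → Bool) (is : List I) xs {c} →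
               (∀ {i} → i ∈ is → count (q i) xs ≤ c) →
               count (λ x → any (λ i → q i x) is) xs ≤ length is * c
  count-any≤ q []       xs _ = ≤-reflexive (count-≡0 xs (λ _ ()))
  count-any≤ q (i ∷ is) xs q-bound =
    ≤-trans (count-∨ (q i) (λ x → any (λ i → q i x) is) xs)
            (+-mono-≤ (q-bound (here refl)) (count-any≤ q is xs (q-bound ∘ there)))

ksub-bounded : ∀ {n k V u} → V ∈ ksub n k → u ∈ V → u < n
ksub-bounded {zero}  {zero}  (here refl) ()
ksub-bounded {suc n} {zero}  (here refl) ()
ksub-bounded {suc n} {suc k} V∈ u∈ with ∈-++⁻ (ksub n (suc k)) V∈
... | inj₁ V∈′ = m≤n⇒m≤1+n (ksub-bounded V∈′ u∈)
... | inj₂ V∈′ with W , W∈ , refl ← ∈-map⁻ (_++ [ n ]) V∈′ with ∈-++⁻ W u∈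
...   | inj₁ u∈W        = m≤n⇒m≤1+n (ksub-bounded W∈ u∈W)
...   | inj₂ (here refl) = ≤-refl

count-ksub-suc : ∀ (p : List ℕ → Bool) n k →
                 count p (ksub (suc n) (suc k)) ≡ count p (ksub n (suc k)) + count (λ V → p (V ++ [ n ])) (ksub n k)
count-ksub-suc p n k =
  trans (count-++ p (ksub n (suc k)) _) (cong (λ c → count p (ksub n (suc k)) + c) (count-map p (_++ [ n ]) (ksub n k)))

count-ksub-suc-avoiding : ∀ {p : List ℕ → Bool} n k → (∀ V → p (V ++ [ n ]) ≡ p V) →
                          count p (ksub (suc n) (suc k)) ≡ count p (ksub n (suc k)) + count p (ksub n k)
count-ksub-suc-avoiding {p} n k p-avoids =
  trans (count-ksub-suc p n k) (cong (λ c → count p (ksub n (suc k)) + c) (count-cong (ksub n k) p-avoids))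

binom : ℕ → ℕ → ℕ
binom n k = length (ksub n k)

binom-zero : ∀ n → binom n 0 ≡ 1
binom-zero zero    = refl
binom-zero (suc n) = refl

binom-suc : ∀ n k → binom (suc n) (suc k) ≡ binom n (suc k) + binom n k
binom-suc n k =
  trans (length-++ (ksub n (suc k))) (cong (λ c → binom n (suc k) + c) (length-map (_++ [ n ]) (ksub n k)))

binom-one : ∀ n → binom n 1 ≡ n
binom-one zero    = refl
binom-one (suc n) = trans (binom-suc n 0) (trans (cong₂ _+_ (binom-one n) (binom-zero n)) (+-comm n 1))

binom-absorb : ∀ n k → suc k * binom (suc n) (suc k) ≡ suc n * binom n k
binom-absorb n zero = begin
  1 * binom (suc n) 1 ≡⟨ +-identityʳ _ ⟩
  binom (suc n) 1     ≡⟨ binom-one (suc n) ⟩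
  suc n               ≡⟨ sym (*-identityʳ (suc n)) ⟩
  suc n * 1           ≡⟨ cong (suc n *_) (sym (binom-zero n)) ⟩
  suc n * binom n 0   ∎
  where open ≡-Reasoning
binom-absorb zero    (suc k) = *-zeroʳ (suc (suc k))
binom-absorb (suc n) (suc k) = begin
  suc (suc k) * binom (suc (suc n)) (suc (suc k)) ≡⟨ cong (suc (suc k) *_) (binom-suc (suc n) (suc k)) ⟩
  suc (suc k) * (A + B)             ≡⟨ regroup (suc k) A B ⟩
  suc (suc k) * A + suc k * B + B   ≡⟨ cong₂ (λ s t → s + t + B) (binom-absorb n (suc k)) (binom-absorb n k) ⟩
  suc n * E + suc n * F + B         ≡⟨ cong (_+ B) (sym (*-distribˡ-+ (suc n) E F)) ⟩
  suc n * (E + F) + B               ≡⟨ cong (λ t → suc n * t + B) (sym (binom-suc n k)) ⟩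
  suc n * B + B                     ≡⟨ +-comm (suc n * B) B ⟩
  suc (suc n) * B                   ∎
  where
  open ≡-Reasoning
  A = binom (suc n) (suc (suc k))
  B = binom (suc n) (suc k)
  E = binom n (suc k)
  F = binom n k
  regroup : ∀ k a b → suc k * (a + b) ≡ suc k * a + k * b + b
  regroup = solve-∀

binom-absorb₂ : ∀ n k → suc n * binom n k * suc (suc n) ≡ suc k * suc (suc k) * binom (suc (suc n)) (suc (suc k))
binom-absorb₂ n k = begin
  suc n * binom n k * N                   ≡⟨ *-comm (suc n * binom n k) N ⟩
  N * (suc n * binom n k)                 ≡⟨ cong (N *_) (sym (binom-absorb n k)) ⟩
  N * (suc k * binom (suc n) (suc k))     ≡⟨ swap N (suc k) (binom (suc n) (suc k)) ⟩
  suc k * (N * binom (suc n) (suc k))     ≡⟨ cong (suc k *_) (sym (binom-absorb (suc n) (suc k))) ⟩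
  suc k * (K * binom N K)                 ≡⟨ sym (*-assoc (suc k) K (binom N K)) ⟩
  suc k * K * binom N K                   ∎
  where
  open ≡-Reasoning
  N = suc (suc n)
  K = suc (suc k)
  swap : ∀ a b c → a * (b * c) ≡ b * (a * c)
  swap = solve-∀

count-∋ : ∀ {x} n k → x ≤ n → count (memℤ (+ x)) (ksub (suc n) (suc k)) ≡ binom n k
count-∋ {x} n k x≤n with x ℕ.≟ n
count-∋ n k _ | yes refl = begin
  count (memℤ (+ n)) (ksub (suc n) (suc k))
    ≡⟨ count-ksub-suc (memℤ (+ n)) n k ⟩
  count (memℤ (+ n)) (ksub n (suc k)) + count (λ V → memℤ (+ n) (V ++ [ n ])) (ksub n k)
    ≡⟨ cong₂ _+_ (count-≡0 (ksub n (suc k)) n∉) (count-≡length (ksub n k) (λ V → memℤ-snoc-self V n)) ⟩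
  binom n k ∎
  where
  open ≡-Reasoning
  n∉ : ∀ {V} → V ∈ ksub n (suc k) → ¬ T (memℤ (+ n) V)
  n∉ {V} V∈ n∈ = <-irrefl refl (ksub-bounded V∈ (memℤ⇒∈ n V n∈))
count-∋ zero k x≤0 | no x≢0 = contradiction (n≤0⇒n≡0 x≤0) x≢0
count-∋ {x} (suc n) k x≤1+n | no x≢1+n = begin
  count (memℤ (+ x)) (ksub (suc (suc n)) (suc k))
    ≡⟨ count-ksub-suc-avoiding (suc n) k (λ V → memℤ-snoc-other V x≢1+n) ⟩
  count (memℤ (+ x)) (ksub (suc n) (suc k)) + count (memℤ (+ x)) (ksub (suc n) k)
    ≡⟨ pascal k ⟩
  binom (suc n) k ∎
  where
  open ≡-Reasoning
  x≤n : x ≤ n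
  x≤n = ≤-pred (≤∧≢⇒< x≤1+n x≢1+n)
  pascal : ∀ k → count (memℤ (+ x)) (ksub (suc n) (suc k)) + count (memℤ (+ x)) (ksub (suc n) k) ≡ binom (suc n) k
  pascal zero    = trans (+-identityʳ _) (trans (count-∋ n 0 x≤n) (trans (binom-zero n) (sym (binom-zero (suc n)))))
  pascal (suc k) = trans (cong₂ _+_ (count-∋ n (suc k) x≤n) (count-∋ n k x≤n)) (sym (binom-suc n k))

contains₂ : ℕ → ℕ → List ℕ → Bool
contains₂ x y V = memℤ (+ x) V ∧ memℤ (+ y) V

-- Stated with pred K so that K = 0 needs no special case: both sides vanish.
count-∋₂ : ∀ {x y} n K → x < y → y ≤ suc n →
           count (contains₂ x y) (ksub (suc (suc n)) K) ≡ count (memℤ (+ x)) (ksub (suc n) (pred K))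
count-∋₂ n zero _ _ = refl
count-∋₂ {x} {y} n (suc k) x<y y≤1+n with y ℕ.≟ suc n
count-∋₂ {x} n (suc k) x<y _ | yes refl = begin
  count (contains₂ x (suc n)) (ksub (suc (suc n)) (suc k))
    ≡⟨ count-ksub-suc (contains₂ x (suc n)) (suc n) k ⟩
  count (contains₂ x (suc n)) (ksub (suc n) (suc k)) + count (λ V → contains₂ x (suc n) (V ++ [ suc n ])) (ksub (suc n) k)
    ≡⟨ cong₂ _+_ (count-≡0 (ksub (suc n) (suc k)) top∉) (count-cong (ksub (suc n) k) snoc-top) ⟩
  count (memℤ (+ x)) (ksub (suc n) k) ∎
  where
  open ≡-Reasoning
  top∉ : ∀ {V} → V ∈ ksub (suc n) (suc k) → ¬ T (contains₂ x (suc n) V)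
  top∉ {V} V∈ h = <-irrefl refl (ksub-bounded V∈ (memℤ⇒∈ (suc n) V (proj₂ (Equivalence.to T-∧ h))))
  snoc-top : ∀ V → contains₂ x (suc n) (V ++ [ suc n ]) ≡ memℤ (+ x) V
  snoc-top V = trans (cong₂ _∧_ (memℤ-snoc-other V (<⇒≢ x<y)) (Equivalence.to T-≡ (memℤ-snoc-self V (suc n))))
                     (∧-identityʳ _)
count-∋₂ zero (suc k) x<y y≤1 | no y≢1 = contradiction (≤-antisym y≤1 (≤-trans (s≤s z≤n) x<y)) y≢1
count-∋₂ {x} {y} (suc n) (suc k) x<y y≤2+n | no y≢2+n = begin
  count (contains₂ x y) (ksub (suc (suc (suc n))) (suc k))
    ≡⟨ count-ksub-suc-avoiding (suc (suc n)) k (λ V → cong₂ _∧_ (memℤ-snoc-other V x≢2+n) (memℤ-snoc-other V y≢2+n)) ⟩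
  count (contains₂ x y) (ksub (suc (suc n)) (suc k)) + count (contains₂ x y) (ksub (suc (suc n)) k)
    ≡⟨ cong₂ _+_ (count-∋₂ n (suc k) x<y y≤1+n) (count-∋₂ n k x<y y≤1+n) ⟩
  count (memℤ (+ x)) (ksub (suc n) k) + count (memℤ (+ x)) (ksub (suc n) (pred k))
    ≡⟨ pascal k ⟩
  count (memℤ (+ x)) (ksub (suc (suc n)) k) ∎
  where
  open ≡-Reasoning
  y≤1+n : y ≤ suc n
  y≤1+n = ≤-pred (≤∧≢⇒< y≤2+n y≢2+n)
  x<1+n : x < suc n
  x<1+n = <-≤-trans x<y y≤1+n
  x≢2+n : x ≢ suc (suc n)
  x≢2+n = <⇒≢ (m≤n⇒m≤1+n x<1+n)
  pascal : ∀ k → count (memℤ (+ x)) (ksub (suc n) k) + count (memℤ (+ x)) (ksub (suc n) (pred k))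
               ≡ count (memℤ (+ x)) (ksub (suc (suc n)) k)
  pascal zero    = refl
  pascal (suc k) = sym (count-ksub-suc-avoiding (suc n) k (λ V → memℤ-snoc-other V (<⇒≢ x<1+n)))

count-∋₂-≤ : ∀ {x y} n k → x < y → count (contains₂ x y) (ksub (suc (suc n)) (suc (suc k))) ≤ binom n k
count-∋₂-≤ {x} {y} n k x<y with y ≤? suc n
... | yes y≤1+n = ≤-reflexive (trans (count-∋₂ n (suc (suc k)) x<y y≤1+n) (count-∋ n k (≤-pred (<-≤-trans x<y y≤1+n))))
... | no  y≰1+n = ≤-trans (≤-reflexive (count-≡0 (ksub (suc (suc n)) (suc (suc k))) y∉)) z≤n
  where
  y∉ : ∀ {V} → V ∈ ksub (suc (suc n)) (suc (suc k)) → ¬ T (contains₂ x y V)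
  y∉ {V} V∈ h = y≰1+n (≤-pred (ksub-bounded V∈ (memℤ⇒∈ y V (proj₂ (Equivalence.to T-∧ h)))))

-- The unconditional bound on Pr(l ∈ W) for l > 0

W-count-bound : ∀ N k d → count (inW (+ suc d)) (ksub N (suc (suc k))) * N
                          ≤ suc (suc k) * suc (suc k) * binom N (suc (suc k))
W-count-bound zero          k d = z≤n
W-count-bound (suc zero)    k d = z≤n
W-count-bound (suc (suc n)) k d = begin
  count (inW (+ suc d)) Vs * N
    ≤⟨ *-monoˡ-≤ N (count-mono Vs has-gap) ⟩
  count (λ V → any (λ a → contains₂ a (a + suc d) V) (upTo (suc n))) Vs * N
    ≤⟨ *-monoˡ-≤ N (count-any≤ (λ a → contains₂ a (a + suc d)) (upTo (suc n)) Vs pair-count) ⟩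
  length (upTo (suc n)) * binom n k * N
    ≡⟨ cong (λ t → t * binom n k * N) (length-upTo (suc n)) ⟩
  suc n * binom n k * N
    ≡⟨ binom-absorb₂ n k ⟩
  suc k * K * binom N K
    ≤⟨ *-monoˡ-≤ (binom N K) (*-monoˡ-≤ K (n≤1+n (suc k))) ⟩
  K * K * binom N K ∎
  where
  open ≤-Reasoning
  N = suc (suc n)
  K = suc (suc k)
  Vs = ksub N K
  pair-count : ∀ {a} → a ∈ upTo (suc n) → count (contains₂ a (a + suc d)) Vs ≤ binom n k
  pair-count {a} _ = count-∋₂-≤ n k (m<m+n a (s≤s z≤n))
  has-gap : ∀ {V} → V ∈ Vs → T (inW (+ suc d) V) → T (any (λ a → contains₂ a (a + suc d) V) (upTo (suc n)))
  has-gap {V} V∈ h with a , a∈ , a+d∈ ← inW-gap V d h =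
    any⁺ (λ a → contains₂ a (a + suc d) V)
      (lose (∈-upTo⁺ (<-≤-trans (m<m+n a (s≤s z≤n)) (≤-pred (ksub-bounded {N} {K} V∈ a+d∈))))
            (Equivalence.from T-∧ (∈⇒memℤ a∈ , ∈⇒memℤ a+d∈)))

-- A, Q, P, B, S count the V with l in W ∖ U, in U, in W, not in U, and all V. The bound
-- Q ≤ P ≤ c·S/n ≤ S/(m+1) gives m·Q ≤ B, that is S·m ≤ (m+1)·B.
conditional-bound : ∀ m n c {A Q P B S} → A + Q ≡ P → Q + B ≡ S → P * n ≤ c * S → (m + 1) * c ≤ n →
                    A * n * m ≤ (m + 1) * c * B
conditional-bound m zero c {A} _ _ _ _ = ≤-trans (≤-reflexive (cong (_* m) (*-zeroʳ A))) z≤n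
conditional-bound m n@(suc _) c {A} {Q} {P} {B} {S} A+Q≡P Q+B≡S P·n≤c·S large = begin
  A * n * m         ≤⟨ *-monoˡ-≤ m (*-monoˡ-≤ n A≤P) ⟩
  P * n * m         ≤⟨ *-monoˡ-≤ m P·n≤c·S ⟩
  c * S * m         ≡⟨ *-assoc c S m ⟩
  c * (S * m)       ≤⟨ *-monoʳ-≤ c S·m≤[m+1]·B ⟩
  c * ((m + 1) * B) ≡⟨ swap c (m + 1) B ⟩
  (m + 1) * c * B   ∎
  where
  open ≤-Reasoning
  swap : ∀ x y z → x * (y * z) ≡ y * x * z
  swap = solve-∀
  A≤P : A ≤ P
  A≤P = subst (A ≤_) A+Q≡P (m≤m+n A Q)
  Q≤P : Q ≤ P
  Q≤P = subst (Q ≤_) A+Q≡P (m≤n+m Q A)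
  m·Q≤B : m * Q ≤ B
  m·Q≤B = +-cancelˡ-≤ Q (m * Q) B (*-cancelʳ-≤ (Q + m * Q) (Q + B) n (begin
    (Q + m * Q) * n     ≡⟨ expand Q m n ⟩
    (m + 1) * (Q * n)   ≤⟨ *-monoʳ-≤ (m + 1) (*-monoˡ-≤ n Q≤P) ⟩
    (m + 1) * (P * n)   ≤⟨ *-monoʳ-≤ (m + 1) P·n≤c·S ⟩
    (m + 1) * (c * S)   ≡⟨ sym (*-assoc (m + 1) c S) ⟩
    (m + 1) * c * S     ≤⟨ *-monoˡ-≤ S large ⟩
    n * S               ≡⟨ cong (n *_) (sym Q+B≡S) ⟩
    n * (Q + B)         ≡⟨ *-comm n (Q + B) ⟩
    (Q + B) * n         ∎))
    where
    expand : ∀ q m n → (q + m * q) * n ≡ (m + 1) * (q * n)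
    expand = solve-∀
  S·m≤[m+1]·B : S * m ≤ (m + 1) * B
  S·m≤[m+1]·B = begin
    S * m           ≡⟨ cong (_* m) (sym Q+B≡S) ⟩
    (Q + B) * m     ≡⟨ expand Q B m ⟩
    m * Q + B * m   ≤⟨ +-monoˡ-≤ (B * m) m·Q≤B ⟩
    B + B * m       ≡⟨ collect B m ⟩
    (m + 1) * B     ∎
    where
    expand : ∀ q b m → (q + b) * m ≡ m * q + b * m
    expand = solve-∀
    collect : ∀ b m → b + b * m ≡ (m + 1) * b
    collect = solve-∀

W∖U-count-vanishes : ∀ {n m R} l Vs → (∀ d → l ≢ + suc d) →
                     count (λ V → inW l V ∧ not (inU l V)) Vs * n * m ≤ R
W∖U-count-vanishes {n} {m} l Vs l≢ = ≤-trans (≤-reflexive (cong (λ c → c * n * m) count≡0)) z≤n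
  where
  count≡0 : count (λ V → inW l V ∧ not (inU l V)) Vs ≡ 0
  count≡0 = count-≡0 Vs (λ {V} _ h → let d , l≡1+d = W∖U-positive l V h in l≢ d l≡1+d)

conditional-W-bound : ∀ m n K → 2 ≤ K → (m + 1) * (K * K) ≤ n → ∀ l →
                      count (λ V → inW l V ∧ not (inU l V)) (ksub n K) * n * m
                      ≤ (m + 1) * (K * K) * count (λ V → not (inU l V)) (ksub n K)
conditional-W-bound m n K@(suc (suc k)) (s≤s (s≤s _)) large l@(+ suc d) =
  conditional-bound m n (K * K) (count-∧-not+count (ksub n K) (inU⇒inW l)) (count+count-not (inU l) (ksub n K))
    (W-count-bound n k d) large
conditional-W-bound m n K _ _ (+ zero)   = W∖U-count-vanishes (+ zero) (ksub n K) (λ _ ())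
conditional-W-bound m n K _ _ -[1+ j ] = W∖U-count-vanishes -[1+ j ] (ksub n K) (λ _ ())
conditional-W-bound m n 1 (s≤s ()) _ _

-- The growth hypothesis makes k² = o(n)

^-distribʳ-* : ∀ m n o → (m * n) ^ o ≡ m ^ o * n ^ o
^-distribʳ-* m n zero    = refl
^-distribʳ-* m n (suc o) = trans (cong (m * n *_) (^-distribʳ-* m n o)) (interchange m n (m ^ o) (n ^ o))
  where
  interchange : ∀ a b c d → a * b * (c * d) ≡ a * c * (b * d)
  interchange = solve-∀

growth-bound⇒below : ∀ {a b D k n} M → 0 < a → 0 < b → 0 < n →
                     k ^ (2 * b) * n ^ (2 * a) ≤ D * n ^ b → n < M * (k * k) → n < M ^ b * D
growth-bound⇒below {a} {b} {D} {k} {n} M 0<a 0<b 0<n growth n<M·k² =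
  ≤-<-trans n≤n^2a (*-cancelˡ-< (n ^ b) (n ^ (2 * a)) (M ^ b * D) (begin-strict
    n ^ b * n ^ (2 * a)                  <⟨ *-monoˡ-< (n ^ (2 * a)) nᵇ<Mᵇ·k^2b ⟩
    M ^ b * k ^ (2 * b) * n ^ (2 * a)    ≡⟨ *-assoc (M ^ b) (k ^ (2 * b)) (n ^ (2 * a)) ⟩
    M ^ b * (k ^ (2 * b) * n ^ (2 * a))  ≤⟨ *-monoʳ-≤ (M ^ b) growth ⟩
    M ^ b * (D * n ^ b)                  ≡⟨ rotate (M ^ b) D (n ^ b) ⟩
    n ^ b * (M ^ b * D)                  ∎))
  where
  open ≤-Reasoning
  instance
    n≢0 : NonZero n
    n≢0 = >-nonZero 0<n
    b≢0 : NonZero b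
    b≢0 = >-nonZero 0<b
    n^2a≢0 : NonZero (n ^ (2 * a))
    n^2a≢0 = m^n≢0 n (2 * a)
  rotate : ∀ x y z → x * (y * z) ≡ z * (x * y)
  rotate = solve-∀
  k²ᵇ≡k^2b : (k * k) ^ b ≡ k ^ (2 * b)
  k²ᵇ≡k^2b = trans (cong (λ t → (k * t) ^ b) (sym (*-identityʳ k))) (^-*-assoc k 2 b)
  nᵇ<Mᵇ·k^2b : n ^ b < M ^ b * k ^ (2 * b)
  nᵇ<Mᵇ·k^2b = subst (n ^ b <_) (trans (^-distribʳ-* M (k * k) b) (cong (M ^ b *_) k²ᵇ≡k^2b)) (^-monoˡ-< b n<M·k²)
  n≤n^2a : n ≤ n ^ (2 * a)
  n≤n^2a = subst (_≤ n ^ (2 * a)) (*-identityʳ n) (^-monoʳ-≤ n (≤-trans 0<a (m≤m+n a (a + 0))))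

eventually-k²-small : ∀ a b → 0 < a → 0 < b → (k : ℕ → ℕ) →
                      (∃[ D ] ∃[ N₀ ] (∀ n → N₀ ≤ n → k n ^ (2 * b) * n ^ (2 * a) ≤ D * n ^ b)) →
                      ∀ M → ∃[ N ] (∀ n → N ≤ n → M * (k n * k n) ≤ n)
eventually-k²-small a b 0<a 0<b k (D , N₀ , growth) M = suc (N₀ + M ^ b * D) , k²-small
  where
  k²-small : ∀ n → suc (N₀ + M ^ b * D) ≤ n → M * (k n * k n) ≤ n
  k²-small n N≤n = ≮⇒≥ (λ n<M·k² → <-asym (growth-bound⇒below M 0<a 0<b 0<n (growth n N₀≤n) n<M·k²) Mᵇ·D<n)
    where
    0<n : 0 < n
    0<n = ≤-trans (s≤s z≤n) N≤n
    N₀≤n : N₀ ≤ n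
    N₀≤n = ≤-trans (m≤n⇒m≤1+n (m≤m+n N₀ (M ^ b * D))) N≤n
    Mᵇ·D<n : M ^ b * D < n
    Mᵇ·D<n = ≤-trans (s≤s (m≤n+m (M ^ b * D) N₀)) N≤n

lemma2 : (a b : ℕ) → 0 < a → 0 < b
         → (k : ℕ → ℕ) → (∀ n → 2 ≤ k n)
         → (∃[ D ] ∃[ N₀ ] (∀ n → N₀ ≤ n → k n ^ (2 * b) * n ^ (2 * a) ≤ D * n ^ b))
         → (∀ (n : ℕ) (l : ℤ)
              → count (λ V → inU l V ∧ inW l V) (ksub n (k n))
                ≡ count (λ V → inU l V) (ksub n (k n)))
           × (∀ (m : ℕ) → 0 < m → ∃[ N ] (∀ n → N ≤ n → ∀ (l : ℤ)
              → count (λ V → inW l V ∧ not (inU l V)) (ksub n (k n)) * n * m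
                ≤ (m + 1) * (k n * k n) * count (λ V → not (inU l V)) (ksub n (k n))))
lemma2 a b 0<a 0<b k 2≤k growth =
  (λ n l → count-cong (ksub n (k n)) (λ V → ∧-redundantʳ (inU⇒inW l V))) ,
  λ m _ → let N , k²-small = eventually-k²-small a b 0<a 0<b k growth (m + 1)
          in N , λ n N≤n → conditional-W-bound m n (k n) (2≤k n) (k²-small n N≤n)
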